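{- Let $\lambda$ be a nonzero real number. For integers $n,r\ge0$ define $T_n(x,r\mid\lambda)=\sum_{k=0}^{n}\binom{n}{k}x^k(k)_{r,\lambda}$. Then for all integers $n,r\ge0$ and every $x\neq-1$, $$ T_{n}(x,r\mid\lambda)=(1+x)^{n}\sum_{j=0}^{r}(-1)^{j}\binom{n}{j}\Big(\frac{x}{1+x}\Big)^{j}\sum_{k=0}^{j}(-1)^{k}\binom{j}{k}(k)_{r,\lambda}. $$ In particular, $$ T_{n}(1,r\mid\lambda)=2^{n}\sum_{j=0}^{r}(-1)^{j}\frac{\binom{n}{j}}{2^{j}}\sum_{k=0}^{j}(-1)^{k}\binom{j}{k}(k)_{r,\lambda}. $$
   Context: For a real parameter $\mu$ the degenerate falling factorials are $(x)_{0,\mu}=1$ and $(x)_{n,\mu}=x(x-\mu)\cdots(x-(n-1)\mu)$ for $n\ge1$. Binomial coefficients $\binom{n}{j}$ for integers $0\le n<j$ are $0$. -}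

module Defs where

open import Level using (Level)
open import Data.Nat using (ℕ; zero; suc)
open import Data.Nat.Combinatorics using (_C_)
open import Algebra.Bundles using (CommutativeRing)

-- Everything is stated over an arbitrary commutative ring R
-- (the paper works over ℝ, which is one instance).
module _ {c ℓ : Level} (R : CommutativeRing c ℓ) where
  open CommutativeRing R using (Carrier; _+_; _*_; -_; _-_; 0#; 1#)

  nat : ℕ → Carrier
  nat zero    = 0#
  nat (suc n) = 1# + nat n

  pow : Carrier → ℕ → Carrier
  pow a zero    = 1#
  pow a (suc n) = a * pow a n

  sgn : ℕ → Carrier
  sgn j = pow (- 1#) j

  -- binomial coefficient (n choose k) in R; zero when k > n
  binom : ℕ → ℕ → Carrier
  binom n k = nat (n C k)

  sumTo : ℕ → (ℕ → Carrier) → Carrier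
  sumTo zero    f = f zero
  sumTo (suc n) f = sumTo n f + f (suc n)

  dfall : Carrier → ℕ → Carrier → Carrier
  dfall x zero    μ = 1#
  dfall x (suc n) μ = dfall x n μ * (x - nat n * μ)

  T : ℕ → Carrier → ℕ → Carrier → Carrier
  T n x r lam = sumTo n (λ k → binom n k * pow x k * dfall (nat k) r lam)

  inner : ℕ → ℕ → Carrier → Carrier
  inner j r lam = sumTo j (λ k → sgn k * binom j k * dfall (nat k) r lam)

module Submission where

-- Expand the degenerate falling factorial in the binomial basis, (k)_{r,λ} = Σ_{i≤r} c_i C(k,i): multiplying
-- by k − rλ acts on the coefficients through k C(k,i) = i C(k,i) + (i+1) C(k,i+1). The weighted binomial
-- transform of C(·,i) is Σ_k C(n,k) C(k,i) y^k = C(n,i) y^i (1+y)^(n−i). At y = x this gives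
-- T_n(x,r) = Σ_i c_i C(n,i) x^i (1+x)^(n−i); at y = −1 it collapses the inner sum for j to (−1)^j c_j,
-- and the two sides then agree term by term, with (1+x)^n = (1+x)^j (1+x)^(n−j) and (1+x)^j inv^j = 1.

open import Defs
open import Level using (Level)
open import Data.Nat using (ℕ; zero; suc; _∸_; _<_; _≤_; z≤n; s≤s)
import Data.Nat as ℕ
import Data.Nat.Properties as ℕ
open import Data.Nat.Combinatorics using (_C_; nC1≡n; nCn≡1; k>n⇒nCk≡0; nCk+nC[k+1]≡[n+1]C[k+1])
open import Data.Product using (_×_; _,_)
open import Function using (_∘_)
open import Relation.Nullary using (¬_; yes; no; contradiction)
open import Relation.Binary.Definitions using (tri<; tri≈; tri>)
open import Relation.Binary.PropositionalEquality as ≡ using (_≡_; _≢_)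
open import Algebra.Bundles using (CommutativeRing)
import Algebra.Properties.Ring as RingProperties
import Algebra.Properties.CommutativeSemigroup as CommutativeSemigroupProperties
import Algebra.Properties.Semiring.Mult as SemiringMult
import Algebra.Properties.CommutativeSemiring.Exp as CommutativeSemiringExp
import Algebra.Solver.Ring.NaturalCoefficients.Default as NaturalCoefficientsSolver

module _ where
  open Data.Nat using (_+_; _*_)
  open import Data.Nat.Tactic.RingSolver using (solve-∀)
  open ≡.≡-Reasoning

  k*kCi≡i*kCi+[1+i]*kC[1+i] : ∀ k i → k * (k C i) ≡ i * (k C i) + suc i * (k C suc i)
  k*kCi≡i*kCi+[1+i]*kC[1+i] zero    zero    = ≡.refl
  k*kCi≡i*kCi+[1+i]*kC[1+i] zero    (suc i) =
    ≡.sym (≡.cong₂ _+_ (ℕ.*-zeroʳ (suc i)) (ℕ.*-zeroʳ (suc (suc i))))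
  k*kCi≡i*kCi+[1+i]*kC[1+i] (suc k) zero    rewrite nC1≡n (suc k) = ℕ.*-comm (suc k) 1
  k*kCi≡i*kCi+[1+i]*kC[1+i] (suc k) (suc i)
    rewrite ≡.sym (nCk+nC[k+1]≡[n+1]C[k+1] k i) | ≡.sym (nCk+nC[k+1]≡[n+1]C[k+1] k (suc i)) = begin
      suc k * (a + b)
        ≡⟨ distribute k a b ⟩
      a + b + (k * a + k * b)
        ≡⟨ ≡.cong₂ (λ u v → a + b + (u + v))
                   (k*kCi≡i*kCi+[1+i]*kC[1+i] k i) (k*kCi≡i*kCi+[1+i]*kC[1+i] k (suc i)) ⟩
      a + b + (i * a + suc i * b + (suc i * b + suc (suc i) * d))
        ≡⟨ collect i a b d ⟩
      suc i * (a + b) + suc (suc i) * (b + d) ∎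
    where
    a = k C i
    b = k C suc i
    d = k C suc (suc i)
    distribute : ∀ k a b → suc k * (a + b) ≡ a + b + (k * a + k * b)
    distribute = solve-∀
    collect : ∀ i a b d → a + b + (i * a + suc i * b + (suc i * b + suc (suc i) * d))
                          ≡ suc i * (a + b) + suc (suc i) * (b + d)
    collect = solve-∀

module _ {c ℓ : Level} (R : CommutativeRing c ℓ) where
  open CommutativeRing R hiding (zero)
  open RingProperties ring using (-1*x≈-x; -‿involutive)
  open CommutativeSemigroupProperties +-commutativeSemigroup using ()
    renaming (interchange to +-interchange; x∙yz≈xz∙y to x+[y+z]≈x+z+y)
  open CommutativeSemigroupProperties *-commutativeSemigroup using ()
    renaming (interchange to *-interchange; x∙yz≈y∙xz to x*[y*z]≈y*[x*z])
  open import Relation.Binary.Reasoning.Setoid setoid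
  open NaturalCoefficientsSolver commutativeSemiring using (solve; _:+_; _:*_; _:=_; con)
  private
    module Mult = SemiringMult semiring
    module Exp = CommutativeSemiringExp commutativeSemiring

  ∑ : ℕ → (ℕ → Carrier) → Carrier
  ∑ = sumTo R

  syntax ∑ n (λ k → e) = ∑[ k ≤ n ] e

  ∑-cong-≤ : ∀ n {f g : ℕ → Carrier} → (∀ k → k ≤ n → f k ≈ g k) → ∑ n f ≈ ∑ n g
  ∑-cong-≤ zero    f≈g = f≈g 0 z≤n
  ∑-cong-≤ (suc n) f≈g =
    +-cong (∑-cong-≤ n (λ k k≤n → f≈g k (ℕ.m≤n⇒m≤1+n k≤n))) (f≈g (suc n) ℕ.≤-refl)

  ∑-cong : ∀ n {f g : ℕ → Carrier} → (∀ k → f k ≈ g k) → ∑ n f ≈ ∑ n g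
  ∑-cong n f≈g = ∑-cong-≤ n (λ k _ → f≈g k)

  ∑-zero : ∀ n {f : ℕ → Carrier} → (∀ k → k ≤ n → f k ≈ 0#) → ∑ n f ≈ 0#
  ∑-zero zero    f≈0 = f≈0 0 z≤n
  ∑-zero (suc n) f≈0 =
    trans (+-cong (∑-zero n (λ k k≤n → f≈0 k (ℕ.m≤n⇒m≤1+n k≤n))) (f≈0 (suc n) ℕ.≤-refl))
          (+-identityˡ 0#)

  ∑-distrib-+ : ∀ n (f g : ℕ → Carrier) → ∑[ k ≤ n ] (f k + g k) ≈ ∑ n f + ∑ n g
  ∑-distrib-+ zero    f g = refl
  ∑-distrib-+ (suc n) f g = trans (+-congʳ (∑-distrib-+ n f g)) (+-interchange _ _ _ _)

  ∑-distribˡ : ∀ n a (f : ℕ → Carrier) → a * ∑ n f ≈ ∑[ k ≤ n ] (a * f k)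
  ∑-distribˡ zero    a f = refl
  ∑-distribˡ (suc n) a f = trans (distribˡ a _ _) (+-congʳ (∑-distribˡ n a f))

  ∑-distribʳ : ∀ n a (f : ℕ → Carrier) → ∑ n f * a ≈ ∑[ k ≤ n ] (f k * a)
  ∑-distribʳ n a f = trans (*-comm _ a) (trans (∑-distribˡ n a f) (∑-cong n (λ k → *-comm a (f k))))

  ∑-unfoldˡ : ∀ n (f : ℕ → Carrier) → ∑ (suc n) f ≈ f 0 + ∑[ k ≤ n ] f (suc k)
  ∑-unfoldˡ zero    f = refl
  ∑-unfoldˡ (suc n) f = trans (+-congʳ (∑-unfoldˡ n f)) (+-assoc _ _ _)

  ∑-dropʳ : ∀ n {f : ℕ → Carrier} → f (suc n) ≈ 0# → ∑ (suc n) f ≈ ∑ n f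
  ∑-dropʳ n f≈0 = trans (+-congˡ f≈0) (+-identityʳ _)

  ∑-comm : ∀ m n (f : ℕ → ℕ → Carrier) →
    ∑[ k ≤ m ] ∑[ i ≤ n ] f k i ≈ ∑[ i ≤ n ] ∑[ k ≤ m ] f k i
  ∑-comm zero    n f = refl
  ∑-comm (suc m) n f = trans (+-congʳ (∑-comm m n f)) (sym (∑-distrib-+ n _ _))

  ∑-single : ∀ r j (f : ℕ → Carrier) → j ≤ r → (∀ i → i ≢ j → f i ≈ 0#) → ∑ r f ≈ f j
  ∑-single zero    zero f z≤n _ = refl
  ∑-single (suc r) j    f j≤1+r f≈0 with j ℕ.≟ suc r
  ... | yes ≡.refl =
    trans (+-congʳ (∑-zero r (λ i i≤r → f≈0 i (ℕ.<⇒≢ (s≤s i≤r))))) (+-identityˡ _)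
  ... | no  j≢1+r  =
    trans (∑-dropʳ r (f≈0 (suc r) (j≢1+r ∘ ≡.sym)))
          (∑-single r j f (ℕ.≤-pred (ℕ.≤∧≢⇒< j≤1+r j≢1+r)) f≈0)

  nat≡×1# : ∀ n → nat R n ≡ n Mult.× 1#
  nat≡×1# zero    = ≡.refl
  nat≡×1# (suc n) = ≡.cong (1# +_) (nat≡×1# n)

  nat-homo-+ : ∀ m n → nat R (m ℕ.+ n) ≈ nat R m + nat R n
  nat-homo-+ m n rewrite nat≡×1# (m ℕ.+ n) | nat≡×1# m | nat≡×1# n = Mult.×-homo-+ 1# m n

  nat-homo-* : ∀ m n → nat R (m ℕ.* n) ≈ nat R m * nat R n
  nat-homo-* m n rewrite nat≡×1# (m ℕ.* n) | nat≡×1# m | nat≡×1# n = Mult.×1-homo-* m n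

  pow≡^ : ∀ a n → pow R a n ≡ a Exp.^ n
  pow≡^ a zero    = ≡.refl
  pow≡^ a (suc n) = ≡.cong (a *_) (pow≡^ a n)

  pow-congˡ : ∀ n {a b} → a ≈ b → pow R a n ≈ pow R b n
  pow-congˡ n {a} {b} a≈b rewrite pow≡^ a n | pow≡^ b n = Exp.^-congˡ n a≈b

  pow-homo-* : ∀ a m n → pow R a (m ℕ.+ n) ≈ pow R a m * pow R a n
  pow-homo-* a m n rewrite pow≡^ a (m ℕ.+ n) | pow≡^ a m | pow≡^ a n = Exp.^-homo-* a m n

  pow-distrib-* : ∀ a b n → pow R (a * b) n ≈ pow R a n * pow R b n
  pow-distrib-* a b n rewrite pow≡^ (a * b) n | pow≡^ a n | pow≡^ b n = Exp.^-distrib-* a b n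

  pow-inverse : ∀ n {a b} → a * b ≈ 1# → pow R a n * pow R b n ≈ 1#
  pow-inverse zero    _     = *-identityˡ 1#
  pow-inverse (suc n) {a} {b} ab≈1 = begin
    a * pow R a n * (b * pow R b n)   ≈⟨ *-interchange a (pow R a n) b (pow R b n) ⟩
    a * b * (pow R a n * pow R b n)   ≈⟨ *-cong ab≈1 (pow-inverse n ab≈1) ⟩
    1# * 1#                           ≈⟨ *-identityˡ 1# ⟩
    1#                                ∎

  sgn*sgn≈1 : ∀ j → sgn R j * sgn R j ≈ 1#
  sgn*sgn≈1 j = pow-inverse j (trans (-1*x≈-x (- 1#)) (-‿involutive 1#))

  pascal : ∀ n k → binom R (suc n) (suc k) ≈ binom R n k + binom R n (suc k)
  pascal n k = trans (reflexive (≡.cong (nat R) (≡.sym (nCk+nC[k+1]≡[n+1]C[k+1] n k))))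
                     (nat-homo-+ (n C k) (n C suc k))

  binom-vanish : ∀ {n k} → n < k → binom R n k ≈ 0#
  binom-vanish n<k = reflexive (≡.cong (nat R) (k>n⇒nCk≡0 n<k))

  nat*binom : ∀ k i → nat R k * binom R k i ≈ nat R i * binom R k i + nat R (suc i) * binom R k (suc i)
  nat*binom k i = begin
    nat R k * binom R k i
      ≈⟨ nat-homo-* k (k C i) ⟨
    nat R (k ℕ.* (k C i))
      ≈⟨ reflexive (≡.cong (nat R) (k*kCi≡i*kCi+[1+i]*kC[1+i] k i)) ⟩
    nat R (i ℕ.* (k C i) ℕ.+ suc i ℕ.* (k C suc i))
      ≈⟨ nat-homo-+ (i ℕ.* (k C i)) (suc i ℕ.* (k C suc i)) ⟩
    nat R (i ℕ.* (k C i)) + nat R (suc i ℕ.* (k C suc i))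
      ≈⟨ +-cong (nat-homo-* i (k C i)) (nat-homo-* (suc i) (k C suc i)) ⟩
    nat R i * binom R k i + nat R (suc i) * binom R k (suc i) ∎

  binom-pow-split : ∀ n j u → binom R n j * pow R u n ≈ binom R n j * (pow R u j * pow R u (n ∸ j))
  binom-pow-split n j u with j ℕ.≤? n
  ... | yes j≤n =
    *-congˡ (trans (reflexive (≡.cong (pow R u) (≡.sym (ℕ.m+[n∸m]≡n j≤n)))) (pow-homo-* u j (n ∸ j)))
  ... | no  j≰n = trans (*-congʳ vanish) (trans (zeroˡ _) (sym (trans (*-congʳ vanish) (zeroˡ _))))
    where vanish = binom-vanish (ℕ.≰⇒> j≰n)

  binomialTransform : ℕ → Carrier → (ℕ → Carrier) → Carrier
  binomialTransform n y g = ∑[ k ≤ n ] (binom R n k * pow R y k * g k)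

  binomialTransform-cong : ∀ n y {g h : ℕ → Carrier} → (∀ k → g k ≈ h k) →
    binomialTransform n y g ≈ binomialTransform n y h
  binomialTransform-cong n y g≈h = ∑-cong n (λ k → *-congˡ (g≈h k))

  binomialTransform-distrib-+ : ∀ n y (g h : ℕ → Carrier) →
    binomialTransform n y (λ k → g k + h k) ≈ binomialTransform n y g + binomialTransform n y h
  binomialTransform-distrib-+ n y g h =
    trans (∑-cong n (λ k → distribˡ _ (g k) (h k))) (∑-distrib-+ n _ _)

  binomialTransform-∑ : ∀ n r y (c : ℕ → Carrier) (g : ℕ → ℕ → Carrier) →
    binomialTransform n y (λ k → ∑[ i ≤ r ] (c i * g i k))
      ≈ ∑[ i ≤ r ] (c i * binomialTransform n y (g i))
  binomialTransform-∑ n r y c g = begin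
    ∑[ k ≤ n ] (binom R n k * pow R y k * ∑[ i ≤ r ] (c i * g i k))
      ≈⟨ ∑-cong n (λ k → trans (∑-distribˡ r _ _) (∑-cong r (λ i → x*[y*z]≈y*[x*z] _ (c i) _))) ⟩
    ∑[ k ≤ n ] ∑[ i ≤ r ] (c i * (binom R n k * pow R y k * g i k))
      ≈⟨ ∑-comm n r _ ⟩
    ∑[ i ≤ r ] ∑[ k ≤ n ] (c i * (binom R n k * pow R y k * g i k))
      ≈⟨ ∑-cong r (λ i → ∑-distribˡ n (c i) _) ⟨
    ∑[ i ≤ r ] (c i * binomialTransform n y (g i)) ∎

  binomialTransform-suc : ∀ n y (g : ℕ → Carrier) →
    binomialTransform (suc n) y g ≈ binomialTransform n y g + y * binomialTransform n y (g ∘ suc)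
  binomialTransform-suc n y g = begin
    binomialTransform (suc n) y g
      ≈⟨ ∑-unfoldˡ n _ ⟩
    -- the head term is t 0 because C(n+1,0) and C(n,0) both compute to 1
    t 0 + ∑[ k ≤ n ] (binom R (suc n) (suc k) * pow R y (suc k) * g (suc k))
      ≈⟨ +-congˡ (∑-cong n (λ k → trans (*-congʳ (trans (*-congʳ (pascal n k)) (distribʳ _ _ _))) (distribʳ _ _ _))) ⟩
    t 0 + ∑[ k ≤ n ] (s k + t (suc k))
      ≈⟨ +-congˡ (∑-distrib-+ n _ _) ⟩
    t 0 + (∑ n s + ∑[ k ≤ n ] t (suc k))
      ≈⟨ x+[y+z]≈x+z+y (t 0) (∑ n s) (∑[ k ≤ n ] t (suc k)) ⟩
    t 0 + ∑[ k ≤ n ] t (suc k) + ∑ n s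
      ≈⟨ +-cong (trans (sym (∑-unfoldˡ n t)) (∑-dropʳ n t[1+n]≈0))
                (trans (∑-cong n (λ k → y*-outward (binom R n k) (pow R y k) (g (suc k)))) (sym (∑-distribˡ n y _))) ⟩
    binomialTransform n y g + y * binomialTransform n y (g ∘ suc) ∎
    where
    t s : ℕ → Carrier
    t k = binom R n k * pow R y k * g k
    s k = binom R n k * pow R y (suc k) * g (suc k)
    y*-outward : ∀ b p z → b * (y * p) * z ≈ y * (b * p * z)
    y*-outward b p z = solve 4 (λ y b p z → b :* (y :* p) :* z := y :* (b :* p :* z)) refl y b p z
    t[1+n]≈0 : t (suc n) ≈ 0#
    t[1+n]≈0 = trans (*-congʳ (trans (*-congʳ (binom-vanish (ℕ.n<1+n n))) (zeroˡ _))) (zeroˡ _)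

  -- The truncated n ∸ i is harmless: the binomial factor vanishes for i > n.
  binomialTerm : ℕ → ℕ → Carrier → Carrier
  binomialTerm n i y = binom R n i * (pow R y i * pow R (1# + y) (n ∸ i))

  binomialTerm-suc : ∀ n i y →
    binomialTerm (suc n) (suc i) y ≈ (1# + y) * binomialTerm n (suc i) y + y * binomialTerm n i y
  binomialTerm-suc n i y with i ℕ.<? n
  ... | yes i<n = begin
    binom R (suc n) (suc i) * (y * p * pow R u (n ∸ i))
      ≈⟨ *-cong (pascal n i) (*-congˡ (reflexive u^[n∸i]≡u*q)) ⟩
    (a + b) * (y * p * (u * q))
      ≈⟨ solve 5 (λ a b y p q → (a :+ b) :* (y :* p :* ((con 1 :+ y) :* q))
                  := (con 1 :+ y) :* (b :* (y :* p :* q)) :+ y :* (a :* (p :* ((con 1 :+ y) :* q))))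
                 refl a b y p q ⟩
    u * (b * (y * p * q)) + y * (a * (p * (u * q)))
      ≈⟨ +-congˡ (*-congˡ (*-congˡ (*-congˡ (reflexive u^[n∸i]≡u*q)))) ⟨
    u * binomialTerm n (suc i) y + y * binomialTerm n i y ∎
    where
    a = binom R n i ; b = binom R n (suc i) ; p = pow R y i ; u = 1# + y ; q = pow R u (n ∸ suc i)
    u^[n∸i]≡u*q : pow R u (n ∸ i) ≡ u * q
    u^[n∸i]≡u*q = ≡.cong (pow R u) (ℕ.+-∸-assoc 1 i<n)
  ... | no  i≮n = begin
    binom R (suc n) (suc i) * (y * p * w)
      ≈⟨ *-congʳ (trans (pascal n i) (+-congˡ b≈0)) ⟩
    (a + 0#) * (y * p * w)
      ≈⟨ solve 6 (λ a y p w u w′ → (a :+ con 0) :* (y :* p :* w)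
                  := u :* (con 0 :* (y :* p :* w′)) :+ y :* (a :* (p :* w)))
           refl a y p w (1# + y) (pow R (1# + y) (n ∸ suc i)) ⟩
    (1# + y) * (0# * (y * p * pow R (1# + y) (n ∸ suc i))) + y * binomialTerm n i y
      ≈⟨ +-congʳ (*-congˡ (*-congʳ b≈0)) ⟨
    (1# + y) * binomialTerm n (suc i) y + y * binomialTerm n i y ∎
    where
    a = binom R n i ; p = pow R y i ; w = pow R (1# + y) (n ∸ i)
    b≈0 : binom R n (suc i) ≈ 0#
    b≈0 = binom-vanish (s≤s (ℕ.≮⇒≥ i≮n))

  binomialTransform-binom : ∀ n i y → binomialTransform n y (λ k → binom R k i) ≈ binomialTerm n i y
  -- nat 1 unfolds to 1# + 0#, hence con 1 :+ con 0 in the solver terms.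
  binomialTransform-binom zero    zero    y =
    solve 0 ((con 1 :+ con 0) :* con 1 :* (con 1 :+ con 0) := (con 1 :+ con 0) :* (con 1 :* con 1)) refl
  binomialTransform-binom zero    (suc i) y = trans (zeroʳ _) (sym (zeroˡ _))
  binomialTransform-binom (suc n) zero    y = begin
    binomialTransform (suc n) y (λ k → binom R k 0)
      ≈⟨ binomialTransform-suc n y _ ⟩
    binomialTransform n y (λ k → binom R k 0) + y * binomialTransform n y (λ k → binom R k 0)
      ≈⟨ +-cong IH (*-congˡ IH) ⟩
    binomialTerm n 0 y + y * binomialTerm n 0 y
      ≈⟨ solve 2 (λ y q → (con 1 :+ con 0) :* (con 1 :* q) :+ y :* ((con 1 :+ con 0) :* (con 1 :* q))
                  := (con 1 :+ con 0) :* (con 1 :* ((con 1 :+ y) :* q)))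
           refl y (pow R (1# + y) n) ⟩
    binomialTerm (suc n) 0 y ∎
    where IH = binomialTransform-binom n 0 y
  binomialTransform-binom (suc n) (suc i) y = begin
    binomialTransform (suc n) y (λ k → binom R k (suc i))
      ≈⟨ binomialTransform-suc n y _ ⟩
    binomialTransform n y (λ k → binom R k (suc i)) + y * binomialTransform n y (λ k → binom R (suc k) (suc i))
      ≈⟨ +-congˡ (*-congˡ (trans (binomialTransform-cong n y (λ k → pascal k i))
                                 (binomialTransform-distrib-+ n y _ _))) ⟩
    binomialTransform n y (λ k → binom R k (suc i))
      + y * (binomialTransform n y (λ k → binom R k i) + binomialTransform n y (λ k → binom R k (suc i)))
      ≈⟨ +-cong (binomialTransform-binom n (suc i) y)
                (*-congˡ (+-cong (binomialTransform-binom n i y) (binomialTransform-binom n (suc i) y))) ⟩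
    b′ + y * (b + b′)
      ≈⟨ solve 3 (λ y b b′ → b′ :+ y :* (b :+ b′) := (con 1 :+ y) :* b′ :+ y :* b) refl y b b′ ⟩
    (1# + y) * b′ + y * b
      ≈⟨ binomialTerm-suc n i y ⟨
    binomialTerm (suc n) (suc i) y ∎
    where b = binomialTerm n i y ; b′ = binomialTerm n (suc i) y

  mulLinear : Carrier → (ℕ → Carrier) → ℕ → Carrier
  mulLinear a c zero    = c zero * (nat R zero + a)
  mulLinear a c (suc i) = c (suc i) * (nat R (suc i) + a) + nat R (suc i) * c i

  ∑-newton-*-linear : ∀ r k a (c : ℕ → Carrier) → c (suc r) ≈ 0# →
    ∑[ i ≤ r ] (c i * binom R k i) * (nat R k + a) ≈ ∑[ i ≤ suc r ] (mulLinear a c i * binom R k i)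
  ∑-newton-*-linear r k a c c[1+r]≈0 = begin
    ∑[ i ≤ r ] (c i * binom R k i) * (nat R k + a)
      ≈⟨ ∑-distribʳ r _ _ ⟩
    ∑[ i ≤ r ] (c i * binom R k i * (nat R k + a))
      ≈⟨ ∑-cong r expand ⟩
    ∑[ i ≤ r ] (s i + t i)
      ≈⟨ ∑-distrib-+ r s t ⟩
    ∑ r s + ∑ r t
      ≈⟨ +-congʳ (∑-dropʳ r (trans (*-congʳ (trans (*-congʳ c[1+r]≈0) (zeroˡ _))) (zeroˡ _))) ⟨
    ∑ (suc r) s + ∑ r t
      ≈⟨ +-congʳ (∑-unfoldˡ r s) ⟩
    s 0 + ∑[ i ≤ r ] s (suc i) + ∑ r t
      ≈⟨ trans (+-assoc _ _ _) (+-congˡ (sym (∑-distrib-+ r _ _))) ⟩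
    s 0 + ∑[ i ≤ r ] (s (suc i) + t i)
      ≈⟨ +-congˡ (∑-cong r (λ i → sym (distribʳ _ _ _))) ⟩
    s 0 + ∑[ i ≤ r ] (mulLinear a c (suc i) * binom R k (suc i))
      ≈⟨ ∑-unfoldˡ r _ ⟨
    ∑[ i ≤ suc r ] (mulLinear a c i * binom R k i) ∎
    where
    s t : ℕ → Carrier
    s i = c i * (nat R i + a) * binom R k i
    t i = nat R (suc i) * c i * binom R k (suc i)
    expand : ∀ i → c i * binom R k i * (nat R k + a) ≈ s i + t i
    expand i = begin
      c i * binom R k i * (nat R k + a)
        ≈⟨ solve 4 (λ c b K a → c :* b :* (K :+ a) := c :* (K :* b) :+ c :* b :* a)
                   refl (c i) (binom R k i) (nat R k) a ⟩
      c i * (nat R k * binom R k i) + c i * binom R k i * a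
        ≈⟨ +-congʳ (*-congˡ (nat*binom k i)) ⟩
      c i * (nat R i * binom R k i + nat R (suc i) * binom R k (suc i)) + c i * binom R k i * a
        ≈⟨ solve 6 (λ c b a I J b′ → c :* (I :* b :+ J :* b′) :+ c :* b :* a
                    := c :* (I :+ a) :* b :+ J :* c :* b′)
             refl (c i) (binom R k i) a (nat R i) (nat R (suc i)) (binom R k (suc i)) ⟩
      s i + t i ∎

  -- dfallCoeff λ r i is i! S₂,λ(r, i), with S₂,λ the degenerate Stirling numbers of the second kind.
  dfallCoeff : Carrier → ℕ → ℕ → Carrier
  dfallCoeff lam zero    zero    = 1#
  dfallCoeff lam zero    (suc i) = 0#
  dfallCoeff lam (suc r) i       = mulLinear (- (nat R r * lam)) (dfallCoeff lam r) i

  dfallCoeff-vanish : ∀ lam {r i} → r < i → dfallCoeff lam r i ≈ 0#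
  dfallCoeff-vanish lam {zero}  {suc i} _           = refl
  dfallCoeff-vanish lam {suc r} {suc i} (s≤s r<i) =
    trans (+-cong (trans (*-congʳ (dfallCoeff-vanish lam (ℕ.m<n⇒m<1+n r<i))) (zeroˡ _))
                  (trans (*-congˡ (dfallCoeff-vanish lam r<i)) (zeroʳ _)))
          (+-identityʳ 0#)

  dfall-newton : ∀ lam r k → dfall R (nat R k) r lam ≈ ∑[ i ≤ r ] (dfallCoeff lam r i * binom R k i)
  dfall-newton lam zero    k = solve 0 (con 1 := con 1 :* (con 1 :+ con 0)) refl
  dfall-newton lam (suc r) k = begin
    dfall R (nat R k) r lam * (nat R k - nat R r * lam)
      ≈⟨ *-congʳ (dfall-newton lam r k) ⟩
    ∑[ i ≤ r ] (dfallCoeff lam r i * binom R k i) * (nat R k - nat R r * lam)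
      ≈⟨ ∑-newton-*-linear r k _ (dfallCoeff lam r) (dfallCoeff-vanish lam {r} ℕ.≤-refl) ⟩
    ∑[ i ≤ suc r ] (dfallCoeff lam (suc r) i * binom R k i) ∎

  binomialTransform-newton : ∀ n r y (c : ℕ → Carrier) {f : ℕ → Carrier} →
    (∀ k → f k ≈ ∑[ i ≤ r ] (c i * binom R k i)) →
    binomialTransform n y f ≈ ∑[ i ≤ r ] (c i * binomialTerm n i y)
  binomialTransform-newton n r y c f≈newton = begin
    binomialTransform n y _
      ≈⟨ binomialTransform-cong n y f≈newton ⟩
    binomialTransform n y (λ k → ∑[ i ≤ r ] (c i * binom R k i))
      ≈⟨ binomialTransform-∑ n r y c (λ i k → binom R k i) ⟩
    ∑[ i ≤ r ] (c i * binomialTransform n y (λ k → binom R k i))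
      ≈⟨ ∑-cong r (λ i → *-congˡ (binomialTransform-binom n i y)) ⟩
    ∑[ i ≤ r ] (c i * binomialTerm n i y) ∎

  T-newton : ∀ n x r lam → T R n x r lam ≈ ∑[ i ≤ r ] (dfallCoeff lam r i * binomialTerm n i x)
  T-newton n x r lam = binomialTransform-newton n r x (dfallCoeff lam r) (dfall-newton lam r)

  binomialTerm-−1-off : ∀ {i j} → i ≢ j → binomialTerm j i (- 1#) ≈ 0#
  binomialTerm-−1-off {i} {j} i≢j with ℕ.<-cmp i j
  ... | tri< i<j _ _ = trans (*-congˡ (trans (*-congˡ 0^[j∸i]≈0) (zeroʳ _))) (zeroʳ _)
    where
    0^[j∸i]≈0 : pow R (1# + - 1#) (j ∸ i) ≈ 0#
    0^[j∸i]≈0 = trans (reflexive (≡.cong (pow R (1# + - 1#)) (ℕ.+-∸-assoc 1 i<j)))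
                      (trans (*-congʳ (-‿inverseʳ 1#)) (zeroˡ _))
  ... | tri≈ _ i≡j _ = contradiction i≡j i≢j
  ... | tri> _ _ j<i = trans (*-congʳ (binom-vanish j<i)) (zeroˡ _)

  binomialTerm-−1-diag : ∀ j → binomialTerm j j (- 1#) ≈ sgn R j
  binomialTerm-−1-diag j =
    trans (*-cong (reflexive (≡.cong (nat R) (nCn≡1 j)))
                  (*-congˡ (reflexive (≡.cong (pow R (1# + - 1#)) (ℕ.n∸n≡0 j)))))
          (solve 1 (λ s → (con 1 :+ con 0) :* (s :* con 1) := s) refl (sgn R j))

  inner-dfallCoeff : ∀ lam {j r} → j ≤ r → inner R j r lam ≈ dfallCoeff lam r j * sgn R j
  inner-dfallCoeff lam {j} {r} j≤r = begin
    inner R j r lam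
      ≈⟨ ∑-cong j (λ k → *-congʳ (*-comm (sgn R k) (binom R j k))) ⟩
    T R j (- 1#) r lam
      ≈⟨ T-newton j (- 1#) r lam ⟩
    ∑[ i ≤ r ] (dfallCoeff lam r i * binomialTerm j i (- 1#))
      ≈⟨ ∑-single r j _ j≤r (λ i i≢j → trans (*-congˡ (binomialTerm-−1-off i≢j)) (zeroʳ _)) ⟩
    dfallCoeff lam r j * binomialTerm j j (- 1#)
      ≈⟨ *-congˡ (binomialTerm-−1-diag j) ⟩
    dfallCoeff lam r j * sgn R j ∎

  T-via-inner : ∀ lam n r x inv → (1# + x) * inv ≈ 1# →
    T R n x r lam ≈ pow R (1# + x) n * ∑[ j ≤ r ] (sgn R j * binom R n j * pow R (x * inv) j * inner R j r lam)
  T-via-inner lam n r x inv u*inv≈1 = begin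
    T R n x r lam
      ≈⟨ T-newton n x r lam ⟩
    ∑[ j ≤ r ] (dfallCoeff lam r j * binomialTerm n j x)
      ≈⟨ ∑-cong-≤ r (λ j j≤r → sym (term j j≤r)) ⟩
    ∑[ j ≤ r ] (pow R u n * (sgn R j * binom R n j * pow R (x * inv) j * inner R j r lam))
      ≈⟨ ∑-distribˡ r (pow R u n) _ ⟨
    pow R u n * ∑[ j ≤ r ] (sgn R j * binom R n j * pow R (x * inv) j * inner R j r lam) ∎
    where
    u = 1# + x
    term : ∀ j → j ≤ r →
      pow R u n * (sgn R j * binom R n j * pow R (x * inv) j * inner R j r lam)
        ≈ dfallCoeff lam r j * binomialTerm n j x
    term j j≤r = begin
      U * (s * b * pow R (x * inv) j * inner R j r lam)
        ≈⟨ *-congˡ (*-cong (*-congˡ (pow-distrib-* x inv j)) (inner-dfallCoeff lam j≤r)) ⟩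
      U * (s * b * (X * I) * (e * s))
        ≈⟨ solve 7 (λ U s b X I e s′ → U :* (s :* b :* (X :* I) :* (e :* s′))
                    := s :* s′ :* (e :* (b :* U :* (X :* I))))
             refl U s b X I e s ⟩
      s * s * (e * (b * U * (X * I)))
        ≈⟨ *-cong (sgn*sgn≈1 j) (*-congˡ (*-congʳ (binom-pow-split n j u))) ⟩
      1# * (e * (b * (B * A) * (X * I)))
        ≈⟨ solve 6 (λ e b B A X I → con 1 :* (e :* (b :* (B :* A) :* (X :* I)))
                    := B :* I :* (e :* (b :* (X :* A))))
             refl e b B A X I ⟩
      B * I * (e * (b * (X * A)))
        ≈⟨ trans (*-congʳ (pow-inverse j u*inv≈1)) (*-identityˡ _) ⟩
      e * binomialTerm n j x ∎
      where
      U = pow R u n ; s = sgn R j ; b = binom R n j ; X = pow R x j ; I = pow R inv j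
      e = dfallCoeff lam r j ; B = pow R u j ; A = pow R u (n ∸ j)

theorem2p18 : ∀ {c ℓ : Level} (R : CommutativeRing c ℓ) →
    let open CommutativeRing R in
    (lam : Carrier) → ¬ (lam ≈ 0#) →
    ((n r : ℕ) (x inv : Carrier) → (1# + x) * inv ≈ 1# →
      T R n x r lam ≈
        pow R (1# + x) n *
          sumTo R r (λ j → sgn R j * binom R n j * pow R (x * inv) j * inner R j r lam))
    ×
    ((n r : ℕ) (half : Carrier) → (1# + 1#) * half ≈ 1# →
      T R n 1# r lam ≈
        pow R (1# + 1#) n *
          sumTo R r (λ j → sgn R j * (binom R n j * pow R half j) * inner R j r lam))
theorem2p18 R lam _ =
  T-via-inner R lam ,
  (λ n r half 2*half≈1 → trans (T-via-inner R lam n r 1# half 2*half≈1)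
     (*-congˡ (∑-cong R r (λ j →
        *-congʳ (trans (*-congˡ (pow-congˡ R j (*-identityˡ half))) (*-assoc _ _ _))))))
  where open CommutativeRing R
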